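{- Let $\pi$ be a permutation of length $n$ with left-to-right maxima decomposition $\pi=M_1B_1\cdots M_tB_t$, and write $\mathrm{out}^{123,312}(\pi)=\tilde B_1\cdots\tilde B_tM_t\cdots M_1$ with $\tilde B_i$ a rearrangement of $B_i$. Then $\pi$ is $\{123,312\}$-sortable if and only if all of the following hold: (1) $M_j=n-t+j$ for each $j=1,\dots,t$; (2) each $B_i$ avoids $213$; (3) $\mathrm{out}^{123,312}(\pi)$ avoids $2\text{ - }3\text{ - }1$; (4) $\mathrm{out}^{123,312}(\pi)$ avoids $2\text{ - }31$.
   Context: A sequence contains a pattern $\tau$ if it has a subsequence order-isomorphic to $\tau$. For a set $T$ of patterns, a $T$-stack is a stack whose content, read top to bottom, must never contain an occurrence of a pattern of $T$; an input is processed greedily: push the next input element if this creates no forbidden occurrence in the stack, otherwise pop the top element to the output; $\mathrm{out}^T(\pi)$ is the resulting output. The $T$-machine is the $T$-stack followed by a $\{21\}$-stack (classical stack, greedy); $\pi$ is $T$-sortable if the output of the $T$-machine on $\pi$ is the increasing permutation. For every permutation, $\mathrm{out}^{123,312}(\pi)$ has the form $\tilde B_1\cdots\tilde B_tM_t\cdots M_1$ with $\tilde B_i$ a rearrangement of $B_i$. The left-to-right maxima decomposition is $\pi=M_1B_1\cdots M_tB_t$ where $M_1<\cdots<M_t$ are the left-to-right maxima (entries larger than all previous ones) and $B_i$ is the factor between $M_i$ and $M_{i+1}$ ($B_t$ after $M_t$). In $\mathrm{out}^{123,312}(\pi)$, a triple $xyz$ is an occurrence of $2\text{ - }3\text{ -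 }1$ if $z<x<y$ with $x\in B_i$, $y\in B_j$, $z\in B_k$ and $i<j<k$; it is an occurrence of $2\text{ - }31$ if $z<x<y$ with $x\in B_i$, $y,z\in B_j$, $i<j$, and $y$ precedes $z$ in $\tilde B_j$. -}

module Defs where

open import Data.Nat.Base using (ℕ; zero; suc; _<ᵇ_; _∸_; _+_; _<_)
open import Data.Bool.Base using (Bool; true; false; _∧_; not; _xor_; T; if_then_else_)
open import Data.List.Base using (List; []; _∷_; [_]; _++_; map; zipWith; length; lookup; take; drop; applyUpTo)
open import Data.Bool.ListAction using (any; and)
open import Data.Nat.ListAction using (sum)
open import Data.List.Membership.Propositional using (_∈_)
open import Data.List.Relation.Binary.Sublist.Propositional using (_⊆_)
open import Data.Fin.Base as Fin using (Fin; toℕ)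
open import Data.Product.Base using (_×_; _,_; proj₁; proj₂; Σ; ∃)
open import Relation.Nullary using (¬_)
open import Relation.Binary.PropositionalEquality using (_≡_)

-- Pattern containment
-- Sequences/permutations are lists of naturals; permutations of length n
-- are lists that are a rearrangement of 1,2,…,n.

subseqs : List ℕ → List (List ℕ)
subseqs [] = [ [] ]
subseqs (x ∷ xs) = map (x ∷_) (subseqs xs) ++ subseqs xs

_iffᵇ_ : Bool → Bool → Bool
a iffᵇ b = not (a xor b)

orderIso : List ℕ → List ℕ → Bool
orderIso [] [] = true
orderIso (x ∷ xs) (y ∷ ys) =
  and (zipWith (λ a b → ((x <ᵇ a) iffᵇ (y <ᵇ b)) ∧ ((a <ᵇ x) iffᵇ (b <ᵇ y))) xs ys)
  ∧ orderIso xs ys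
orderIso _ _ = false

contains : List ℕ → List ℕ → Bool
contains s τ = any (λ σ → orderIso σ τ) (subseqs s)

Contains : List ℕ → List ℕ → Set
Contains s τ = T (contains s τ)

Avoids : List ℕ → List ℕ → Set
Avoids s τ = ¬ Contains s τ

containsSome : List (List ℕ) → List ℕ → Bool
containsSome Ts s = any (contains s) Ts

-- T-stacks (greedy). The stack is a list whose head is the top, so the
-- list read left to right is the stack content read top to bottom.

mutual
  -- run Ts input stack = output produced from this point on
  run : List (List ℕ) → List ℕ → List ℕ → List ℕ
  run Ts [] stack = stack
  run Ts (x ∷ xs) stack = step Ts x xs stack

  step : List (List ℕ) → ℕ → List ℕ → List ℕ → List ℕ
  step Ts x xs stack with containsSome Ts (x ∷ stack)
  ... | false = run Ts xs (x ∷ stack)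
  step Ts x xs [] | true = run Ts xs [ x ]      -- (never happens for patterns of length ≥ 2)
  step Ts x xs (s ∷ ss) | true = s ∷ step Ts x xs ss

out : List (List ℕ) → List ℕ → List ℕ
out Ts π = run Ts π []

-- T-machine: T-stack followed by a classical ({21}-)stack
machine : List (List ℕ) → List ℕ → List ℕ
machine Ts π = out ((2 ∷ 1 ∷ []) ∷ []) (out Ts π)

idPerm : ℕ → List ℕ
idPerm n = applyUpTo suc n

Sortable : List (List ℕ) → ℕ → List ℕ → Set
Sortable Ts n π = machine Ts π ≡ idPerm n

T123-312 : List (List ℕ)
T123-312 = (1 ∷ 2 ∷ 3 ∷ []) ∷ (3 ∷ 1 ∷ 2 ∷ []) ∷ []

-- Left-to-right maxima decomposition π = M₁B₁⋯M_tB_t, as the list of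
-- pairs (M_i , B_i).

ltrGo : ℕ → List ℕ → List ℕ → List (ℕ × List ℕ)
ltrGo m blk [] = [ (m , blk) ]
ltrGo m blk (y ∷ ys) =
  if m <ᵇ y then (m , blk) ∷ ltrGo y [] ys else ltrGo m (blk ++ [ y ]) ys

ltrDecomp : List ℕ → List (ℕ × List ℕ)
ltrDecomp [] = []
ltrDecomp (x ∷ xs) = ltrGo x [] xs

nMax : List ℕ → ℕ
nMax π = length (ltrDecomp π)

-- indices 0,…,t-1 (index i stands for the paper's i+1)
Idx : List ℕ → Set
Idx π = Fin (nMax π)

M : (π : List ℕ) → Idx π → ℕ
M π i = proj₁ (lookup (ltrDecomp π) i)

B : (π : List ℕ) → Idx π → List ℕ
B π i = proj₂ (lookup (ltrDecomp π) i)

-- B̃_i: the factor of out^{123,312}(π) = B̃₁⋯B̃_t M_t⋯M₁ at the position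
-- of the i-th block, i.e. after |B₁|+⋯+|B_{i-1}| letters, of length |B_i|.
offset : (π : List ℕ) → Idx π → ℕ
offset π i = sum (map (λ p → length (proj₂ p)) (take (toℕ i) (ltrDecomp π)))

Btilde : (π : List ℕ) → Idx π → List ℕ
Btilde π i = take (length (B π i)) (drop (offset π i) (out T123-312 π))

_precedes_within_ : ℕ → ℕ → List ℕ → Set
y precedes z within L = (y ∷ z ∷ []) ⊆ L

Cond1 : ℕ → List ℕ → Set
Cond1 n π = (j : Idx π) → M π j ≡ n ∸ nMax π + suc (toℕ j)

Cond2 : List ℕ → Set
Cond2 π = (i : Idx π) → Avoids (B π i) (2 ∷ 1 ∷ 3 ∷ [])

-- occurrence of 2-3-1 in out^{123,312}(π)
Occ2-3-1 : (π : List ℕ) → Set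
Occ2-3-1 π = Σ (Idx π) λ i → Σ (Idx π) λ j → Σ (Idx π) λ k → Σ ℕ λ x → Σ ℕ λ y → Σ ℕ λ z →
  (z < x) × (x < y) × (x ∈ B π i) × (y ∈ B π j) × (z ∈ B π k) × (i Fin.< j) × (j Fin.< k)

-- occurrence of 2-31 in out^{123,312}(π)
Occ2-31 : (π : List ℕ) → Set
Occ2-31 π = Σ (Idx π) λ i → Σ (Idx π) λ j → Σ ℕ λ x → Σ ℕ λ y → Σ ℕ λ z →
  (z < x) × (x < y) × (x ∈ B π i) × (y ∈ B π j) × (z ∈ B π j) × (i Fin.< j)
  × (y precedes z within Btilde π j)

Cond3 : List ℕ → Set
Cond3 π = ¬ Occ2-3-1 π

Cond4 : List ℕ → Set
Cond4 π = ¬ Occ2-31 π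

-- A new left-to-right maximum y pops every block entry a stacked above the
-- previous maximum m, since y a m is a 312; so the {123,312}-stack outputs
-- the blocks first and the maxima last, as M_t⋯M₁. The classical stack sorts
-- exactly the inputs avoiding 231. A block entry u ∈ B_i above an earlier
-- maximum M_j gives the 231 u M_i M_j; for a permutation of 1..n, the block
-- entries all lie below all maxima precisely under condition (1). Then the
-- maximum at the bottom turns the 123-restriction into a {12}-stack on each
-- block, and the output is out₁₂(B₁)⋯out₁₂(B_t) M_t⋯M₁. A 231 in it either
-- spreads over several blocks, which (3) and (4) exclude, or its 2 and 3 are
-- an ascent of one out₁₂(B_i); splitting B_i at its minimum shows that this
-- happens only if B_i contains 213, while a 213 in B_i yields a 231 in
-- out₁₂(B_i).

module Submission where

open import Data.Bool.Base using (true; false; _∧_; T; if_then_else_)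
open import Data.Bool.Properties using (T-∧; T-∨; T-≡)
open import Data.Empty using (⊥; ⊥-elim)
open import Data.Fin.Base as Fin using (Fin; zero; suc; toℕ)
import Data.Fin.Properties as Fin
open import Data.List.Base
  using (List; []; _∷_; [_]; _++_; map; length; concatMap; _ʳ++_; lookup; take; drop)
open import Data.List.Membership.Propositional using (_∈_; find; lose)
open import Data.List.Membership.Propositional.Properties
  using (∈-++⁺ˡ; ∈-++⁺ʳ; ∈-++⁻; ∈-map⁺; ∈-map⁻; ∈-applyUpTo⁺; ∈-applyUpTo⁻; ∈-lookup)
open import Data.List.Properties using (++-identityʳ; ++-assoc; length-++)
open import Data.List.Relation.Binary.Permutation.Propositional
  using (_↭_; ↭-sym; ↭-trans; ↭-prep; ↭-reflexive; ↭⇒↭ₛ)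
open import Data.List.Relation.Binary.Permutation.Propositional.Properties
  using (shift; ∈-resp-↭; All-resp-↭; ↭-length; drop-∷)
open import Data.List.Relation.Binary.Sublist.Propositional
  using (_⊆_; []; _∷_; _∷ʳ_; minimum; from∈; ⊆-refl; ⊆-trans)
open import Data.List.Relation.Binary.Sublist.Propositional.Properties
  using (∷ˡ⁻; ∷⁻; ++⁺; ++⁺ˡ; ++⁺ʳ; Any-resp-⊆)
open import Data.List.Relation.Unary.All as All using (All; []; _∷_)
import Data.List.Relation.Unary.All.Properties as All
open import Data.List.Relation.Unary.AllPairs as AllPairs using (AllPairs; []; _∷_)
import Data.List.Relation.Unary.AllPairs.Properties as AllPairs
open import Data.List.Relation.Unary.Any using (here; there)
open import Data.List.Relation.Unary.Any.Properties using (any⁺; any⁻)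
open import Data.List.Relation.Unary.Unique.Propositional using (Unique)
open import Data.Nat.Base
open import Data.Nat.Induction using (<-wellFounded)
open import Data.Nat.ListAction using (sum)
open import Data.Nat.Properties
open import Data.Product.Base using (_×_; _,_; proj₁; proj₂; ∃-syntax)
open import Data.Sum.Base using (_⊎_; inj₁; inj₂)
open import Data.Unit using (⊤; tt)
open import Function.Base using (_∘_; _∘′_)
open import Function.Bundles using (_⇔_; mk⇔; Equivalence)
open import Function.Properties.Equivalence using () renaming (trans to ⇔-trans)
open import Induction.WellFounded using (WellFounded; Acc; acc)
open import Relation.Binary.Construct.On as On using ()
open import Relation.Binary.Definitions using (tri<; tri≈; tri>)
open import Relation.Binary.PropositionalEquality hiding ([_])
open import Data.List.Relation.Binary.Permutation.Setoid.Properties (setoid ℕ) using (Unique-resp-↭)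
open import Relation.Nullary using (¬_; contradiction; yes; no)

open import Defs

open Equivalence using (to; from)
open ≡-Reasoning

⊆⇒∈-subseqs : ∀ {σ s : List ℕ} → σ ⊆ s → σ ∈ subseqs s
⊆⇒∈-subseqs [] = here refl
⊆⇒∈-subseqs {s = y ∷ ys} (.y ∷ʳ τ) = ∈-++⁺ʳ (map (y ∷_) (subseqs ys)) (⊆⇒∈-subseqs τ)
⊆⇒∈-subseqs (refl ∷ τ) = ∈-++⁺ˡ (∈-map⁺ _ (⊆⇒∈-subseqs τ))

∈-subseqs⇒⊆ : ∀ {σ} s → σ ∈ subseqs s → σ ⊆ s
∈-subseqs⇒⊆ [] (here refl) = []
∈-subseqs⇒⊆ (x ∷ xs) σ∈ with ∈-++⁻ (map (x ∷_) (subseqs xs)) σ∈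
... | inj₂ σ∈′ = x ∷ʳ ∈-subseqs⇒⊆ xs σ∈′
... | inj₁ σ∈′ with ∈-map⁻ (x ∷_) σ∈′
...   | _ , σ∈″ , refl = refl ∷ ∈-subseqs⇒⊆ xs σ∈″

Contains⇔subsequence : ∀ {s τ} → Contains s τ ⇔ (∃[ σ ] σ ⊆ s × T (orderIso σ τ))
Contains⇔subsequence {s} {τ} = mk⇔ to′ from′
  where
  to′ : Contains s τ → ∃[ σ ] σ ⊆ s × T (orderIso σ τ)
  to′ c with find (any⁻ (λ σ → orderIso σ τ) (subseqs s) c)
  ... | σ , σ∈ , iso = σ , ∈-subseqs⇒⊆ s σ∈ , iso
  from′ : ∃[ σ ] σ ⊆ s × T (orderIso σ τ) → Contains s τ
  from′ (σ , σ⊆s , iso) = any⁺ (λ σ → orderIso σ τ) (lose (⊆⇒∈-subseqs σ⊆s) iso)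

record SameOrder (u v p q : ℕ) : Set where
  constructor sameOrder
  field
    <-agrees : (u <ᵇ v) ≡ (p <ᵇ q)
    >-agrees : (v <ᵇ u) ≡ (q <ᵇ p)

T-iffᵇ : ∀ {x y} → T (x iffᵇ y) ⇔ x ≡ y
T-iffᵇ {false} {false} = mk⇔ (λ _ → refl) (λ _ → tt)
T-iffᵇ {true}  {true}  = mk⇔ (λ _ → refl) (λ _ → tt)
T-iffᵇ {false} {true}  = mk⇔ (λ ()) (λ ())
T-iffᵇ {true}  {false} = mk⇔ (λ ()) (λ ())

T-comparison⇔SameOrder : ∀ {x y a b} →
  T (((x <ᵇ a) iffᵇ (y <ᵇ b)) ∧ ((a <ᵇ x) iffᵇ (b <ᵇ y))) ⇔ SameOrder x a y b
T-comparison⇔SameOrder = mk⇔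
  (λ t → let t₁ , t₂ = to T-∧ t in sameOrder (to T-iffᵇ t₁) (to T-iffᵇ t₂))
  (λ (sameOrder e₁ e₂) → from T-∧ (from T-iffᵇ e₁ , from T-iffᵇ e₂))

orderIso₂⇔ : ∀ {a b p q} → T (orderIso (a ∷ b ∷ []) (p ∷ q ∷ [])) ⇔ SameOrder a b p q
orderIso₂⇔ = mk⇔
  (λ t → to T-comparison⇔SameOrder (proj₁ (to T-∧ (proj₁ (to T-∧ t)))))
  (λ o → from T-∧ (from T-∧ (from T-comparison⇔SameOrder o , tt) , tt))

orderIso₃⇔ : ∀ {a b c p q r} → T (orderIso (a ∷ b ∷ c ∷ []) (p ∷ q ∷ r ∷ [])) ⇔
  (SameOrder a b p q × SameOrder a c p r × SameOrder b c q r)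
orderIso₃⇔ = mk⇔
  (λ t → let heads , tails = to T-∧ t
             ab , rest = to T-∧ heads
             bc = proj₁ (to T-∧ (proj₁ (to T-∧ tails)))
         in to T-comparison⇔SameOrder ab
          , to T-comparison⇔SameOrder (proj₁ (to T-∧ rest))
          , to T-comparison⇔SameOrder bc)
  (λ (ab , ac , bc) → from T-∧
    ( from T-∧ (from T-comparison⇔SameOrder ab , from T-∧ (from T-comparison⇔SameOrder ac , tt))
    , from T-∧ (from T-∧ (from T-comparison⇔SameOrder bc , tt) , tt)))

orderIso⇒length≡ : ∀ σ τ → T (orderIso σ τ) → length σ ≡ length τ
orderIso⇒length≡ [] [] _ = refl
orderIso⇒length≡ (x ∷ σ) (y ∷ τ) t = cong suc (orderIso⇒length≡ σ τ (proj₂ (to T-∧ t)))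

¬T⇒≡false : ∀ {b} → ¬ T b → b ≡ false
¬T⇒≡false {false} _ = refl
¬T⇒≡false {true} ¬t = ⊥-elim (¬t tt)

<⇒sameOrder : ∀ {u v p q} → u < v → T (p <ᵇ q) → SameOrder u v p q
<⇒sameOrder {u} {v} {p} {q} u<v p<ᵇq = sameOrder
  (trans (to T-≡ (<⇒<ᵇ u<v)) (sym (to T-≡ p<ᵇq)))
  (trans (¬T⇒≡false (<⇒≯ u<v ∘′ <ᵇ⇒< v u)) (sym (¬T⇒≡false (<⇒≯ p<q ∘′ <ᵇ⇒< q p))))
  where p<q = <ᵇ⇒< p q p<ᵇq

SameOrder-sym : ∀ {u v p q} → SameOrder u v p q → SameOrder v u q p
SameOrder-sym (sameOrder e₁ e₂) = sameOrder e₂ e₁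

>⇒sameOrder : ∀ {u v p q} → v < u → T (q <ᵇ p) → SameOrder u v p q
>⇒sameOrder {p = p} {q} v<u q<ᵇp = SameOrder-sym (<⇒sameOrder {p = q} {p} v<u q<ᵇp)

sameOrder⇒< : ∀ {u v p q} → SameOrder u v p q → T (p <ᵇ q) → u < v
sameOrder⇒< (sameOrder e _) t = <ᵇ⇒< _ _ (subst T (sym e) t)

sameOrder⇒> : ∀ {u v p q} → SameOrder u v p q → T (q <ᵇ p) → v < u
sameOrder⇒> (sameOrder _ e) t = <ᵇ⇒< _ _ (subst T (sym e) t)

Occ₃ : (ℕ → ℕ → ℕ → Set) → List ℕ → Set
Occ₃ R s = ∃[ a ] ∃[ b ] ∃[ c ] (a ∷ b ∷ c ∷ []) ⊆ s × R a b c

Occ123 Occ312 Occ213 Occ231 : List ℕ → Set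
Occ123 = Occ₃ λ a b c → a < b × b < c
Occ312 = Occ₃ λ a b c → b < c × c < a
Occ213 = Occ₃ λ a b c → b < a × a < c
Occ231 = Occ₃ λ a b c → c < a × a < b

Occ₂ : (ℕ → ℕ → Set) → List ℕ → Set
Occ₂ R s = ∃[ a ] ∃[ b ] (a ∷ b ∷ []) ⊆ s × R a b

Occ21 : List ℕ → Set
Occ21 = Occ₂ λ a b → b < a

Occ₃-⊆ : ∀ {R s s′} → s ⊆ s′ → Occ₃ R s → Occ₃ R s′
Occ₃-⊆ s⊆s′ (a , b , c , τ , r) = a , b , c , ⊆-trans τ s⊆s′ , r

SameOrder₃ : ℕ → ℕ → ℕ → ℕ → ℕ → ℕ → Set
SameOrder₃ p q r a b c = SameOrder a b p q × SameOrder a c p r × SameOrder b c q r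

Contains₃⇔ : ∀ {s p q r} → Contains s (p ∷ q ∷ r ∷ []) ⇔ Occ₃ (SameOrder₃ p q r) s
Contains₃⇔ {s} {p} {q} {r} = mk⇔ to′
  (λ (a , b , c , τ , o) → from Contains⇔subsequence (_ , τ , from orderIso₃⇔ o))
  where
  occurrence : ∀ σ → σ ⊆ s → T (orderIso σ (p ∷ q ∷ r ∷ [])) → Occ₃ (SameOrder₃ p q r) s
  occurrence (a ∷ b ∷ c ∷ []) τ iso = a , b , c , τ , to orderIso₃⇔ iso
  occurrence [] _ ()
  occurrence (_ ∷ []) _ ()
  occurrence σ@(_ ∷ _ ∷ []) _ iso with () ← orderIso⇒length≡ σ (p ∷ q ∷ r ∷ []) iso
  occurrence σ@(_ ∷ _ ∷ _ ∷ _ ∷ _) _ iso with () ← orderIso⇒length≡ σ (p ∷ q ∷ r ∷ []) iso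

  to′ : Contains s (p ∷ q ∷ r ∷ []) → Occ₃ (SameOrder₃ p q r) s
  to′ c = let σ , τ , iso = to Contains⇔subsequence c in occurrence σ τ iso

Contains₂⇔ : ∀ {s p q} → Contains s (p ∷ q ∷ []) ⇔ Occ₂ (λ a b → SameOrder a b p q) s
Contains₂⇔ {s} {p} {q} = mk⇔ to′
  (λ (a , b , τ , o) → from Contains⇔subsequence (_ , τ , from orderIso₂⇔ o))
  where
  occurrence : ∀ σ → σ ⊆ s → T (orderIso σ (p ∷ q ∷ [])) → Occ₂ (λ a b → SameOrder a b p q) s
  occurrence (a ∷ b ∷ []) τ iso = a , b , τ , to orderIso₂⇔ iso
  occurrence [] _ ()
  occurrence (_ ∷ []) _ ()
  occurrence σ@(_ ∷ _ ∷ _ ∷ _) _ iso with () ← orderIso⇒length≡ σ (p ∷ q ∷ []) iso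

  to′ : Contains s (p ∷ q ∷ []) → Occ₂ (λ a b → SameOrder a b p q) s
  to′ c = let σ , τ , iso = to Contains⇔subsequence c in occurrence σ τ iso

Contains-123⇔ : ∀ {s} → Contains s (1 ∷ 2 ∷ 3 ∷ []) ⇔ Occ123 s
Contains-123⇔ = mk⇔
  (λ c → let a , b , c , τ , ab , _ , bc = to Contains₃⇔ c
         in a , b , c , τ , sameOrder⇒< ab tt , sameOrder⇒< bc tt)
  (λ (a , b , c , τ , a<b , b<c) → from Contains₃⇔
    (a , b , c , τ , <⇒sameOrder a<b tt , <⇒sameOrder (<-trans a<b b<c) tt , <⇒sameOrder b<c tt))

Contains-312⇔ : ∀ {s} → Contains s (3 ∷ 1 ∷ 2 ∷ []) ⇔ Occ312 s
Contains-312⇔ = mk⇔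
  (λ c → let a , b , c , τ , _ , ac , bc = to Contains₃⇔ c
         in a , b , c , τ , sameOrder⇒< bc tt , sameOrder⇒> ac tt)
  (λ (a , b , c , τ , b<c , c<a) → from Contains₃⇔
    (a , b , c , τ , >⇒sameOrder (<-trans b<c c<a) tt , >⇒sameOrder c<a tt , <⇒sameOrder b<c tt))

Contains-213⇔ : ∀ {s} → Contains s (2 ∷ 1 ∷ 3 ∷ []) ⇔ Occ213 s
Contains-213⇔ = mk⇔
  (λ c → let a , b , c , τ , ab , ac , _ = to Contains₃⇔ c
         in a , b , c , τ , sameOrder⇒> ab tt , sameOrder⇒< ac tt)
  (λ (a , b , c , τ , b<a , a<c) → from Contains₃⇔
    (a , b , c , τ , >⇒sameOrder b<a tt , <⇒sameOrder a<c tt , <⇒sameOrder (<-trans b<a a<c) tt))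

Contains-21⇔ : ∀ {s} → Contains s (2 ∷ 1 ∷ []) ⇔ Occ21 s
Contains-21⇔ = mk⇔
  (λ c → let a , b , τ , ab = to Contains₂⇔ c in a , b , τ , sameOrder⇒> ab tt)
  (λ (a , b , τ , b<a) → from Contains₂⇔ (a , b , τ , >⇒sameOrder b<a tt))

T21 : List (List ℕ)
T21 = (2 ∷ 1 ∷ []) ∷ []

T-containsSome-123-312⇔ : ∀ {s} → T (containsSome T123-312 s) ⇔ (Occ123 s ⊎ Occ312 s)
T-containsSome-123-312⇔ {s} = mk⇔ to′ from′
  where
  to′ : T (containsSome T123-312 s) → Occ123 s ⊎ Occ312 s
  to′ t with to T-∨ t
  ... | inj₁ c = inj₁ (to Contains-123⇔ c)
  ... | inj₂ t′ with to T-∨ t′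
  ...   | inj₁ c = inj₂ (to Contains-312⇔ c)
  from′ : Occ123 s ⊎ Occ312 s → T (containsSome T123-312 s)
  from′ (inj₁ o) = from T-∨ (inj₁ (from Contains-123⇔ o))
  from′ (inj₂ o) = from (T-∨ {contains s (1 ∷ 2 ∷ 3 ∷ [])})
    (inj₂ (from (T-∨ {y = false}) (inj₁ (from Contains-312⇔ o))))

T-containsSome-21⇔ : ∀ {s} → T (containsSome T21 s) ⇔ Occ21 s
T-containsSome-21⇔ {s} = mk⇔ to′ (λ o → from T-∨ (inj₁ (from Contains-21⇔ o)))
  where
  to′ : T (containsSome T21 s) → Occ21 s
  to′ t with to T-∨ t
  ... | inj₁ c = to Contains-21⇔ c

head-∈ : ∀ {x : ℕ} {xs ys} → (x ∷ xs) ⊆ ys → x ∈ ys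
head-∈ τ = Any-resp-⊆ τ (here refl)

AllPairs-⊆ : ∀ {R : ℕ → ℕ → Set} {xs a b} → AllPairs R xs → (a ∷ b ∷ []) ⊆ xs → R a b
AllPairs-⊆ (_ ∷ rs) (_ ∷ʳ τ) = AllPairs-⊆ rs τ
AllPairs-⊆ (r ∷ _) (refl ∷ τ) = All.lookup r (head-∈ τ)

data Split₂ (a b : ℕ) (P Q : List ℕ) : Set where
  both-left  : (a ∷ b ∷ []) ⊆ P → Split₂ a b P Q
  across     : a ∈ P → b ∈ Q → Split₂ a b P Q
  both-right : (a ∷ b ∷ []) ⊆ Q → Split₂ a b P Q

data Split₃ (a b c : ℕ) (P Q : List ℕ) : Set where
  all-left  : (a ∷ b ∷ c ∷ []) ⊆ P → Split₃ a b c P Q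
  two-left  : (a ∷ b ∷ []) ⊆ P → c ∈ Q → Split₃ a b c P Q
  one-left  : a ∈ P → (b ∷ c ∷ []) ⊆ Q → Split₃ a b c P Q
  all-right : (a ∷ b ∷ c ∷ []) ⊆ Q → Split₃ a b c P Q

split₂ : ∀ {a b} P {Q} → (a ∷ b ∷ []) ⊆ P ++ Q → Split₂ a b P Q
split₂ [] τ = both-right τ
split₂ (p ∷ P) (.p ∷ʳ τ) with split₂ P τ
... | both-left σ = both-left (p ∷ʳ σ)
... | across a∈ b∈ = across (there a∈) b∈
... | both-right σ = both-right σ
split₂ (p ∷ P) (refl ∷ τ) with ∈-++⁻ P (head-∈ τ)
... | inj₁ b∈ = both-left (refl ∷ from∈ b∈)
... | inj₂ b∈ = across (here refl) b∈

split₃ : ∀ {a b c} P {Q} → (a ∷ b ∷ c ∷ []) ⊆ P ++ Q → Split₃ a b c P Q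
split₃ [] τ = all-right τ
split₃ (p ∷ P) (.p ∷ʳ τ) with split₃ P τ
... | all-left σ = all-left (p ∷ʳ σ)
... | two-left σ c∈ = two-left (p ∷ʳ σ) c∈
... | one-left a∈ σ = one-left (there a∈) σ
... | all-right σ = all-right σ
split₃ (p ∷ P) (refl ∷ τ) with split₂ P τ
... | both-left σ = all-left (refl ∷ σ)
... | across b∈ c∈ = two-left (refl ∷ from∈ b∈) c∈
... | both-right σ = one-left (here refl) σ

Decreasing NonIncreasing NonDecreasing : List ℕ → Set
Decreasing = AllPairs _>_
NonIncreasing = AllPairs _≥_
NonDecreasing = AllPairs _≤_

_≺_ : List ℕ → List ℕ → Set
P ≺ Q = All (λ p → All (p <_) Q) P

Avoids-123-312 : List ℕ → Set
Avoids-123-312 s = ¬ (Occ123 s ⊎ Occ312 s)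

containsSome-123-312≡false : ∀ {s} → Avoids-123-312 s → containsSome T123-312 s ≡ false
containsSome-123-312≡false av = ¬T⇒≡false (av ∘′ to T-containsSome-123-312⇔)

containsSome-123-312≡true : ∀ {s} → Occ123 s ⊎ Occ312 s → containsSome T123-312 s ≡ true
containsSome-123-312≡true o = to T-≡ (from T-containsSome-123-312⇔ o)

-- Both patterns end with an ascent, which a decreasing list cannot host.
∷-decreasing-avoids-123-312 : ∀ y {Q} → Decreasing Q → Avoids-123-312 (y ∷ Q)
∷-decreasing-avoids-123-312 y dec (inj₁ (_ , _ , _ , τ , _ , b<c)) = <⇒≯ b<c (AllPairs-⊆ dec (∷⁻ τ))
∷-decreasing-avoids-123-312 y dec (inj₂ (_ , _ , _ , τ , b<c , _)) = <⇒≯ b<c (AllPairs-⊆ dec (∷⁻ τ))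

++-avoids-123-312 : ∀ P {Q} → NonIncreasing P → Decreasing Q → P ≺ Q → Avoids-123-312 (P ++ Q)
++-avoids-123-312 P nonInc dec P≺Q (inj₁ (a , b , c , τ , a<b , b<c)) with split₃ P τ
... | all-left σ = <⇒≱ a<b (AllPairs-⊆ nonInc (⊆-trans (refl ∷ refl ∷ c ∷ʳ []) σ))
... | two-left σ _ = <⇒≱ a<b (AllPairs-⊆ nonInc σ)
... | one-left _ σ = <⇒≯ b<c (AllPairs-⊆ dec σ)
... | all-right σ = <⇒≯ b<c (AllPairs-⊆ dec (∷ˡ⁻ σ))
++-avoids-123-312 P nonInc dec P≺Q (inj₂ (a , b , c , τ , b<c , c<a)) with split₃ P τ
... | all-left σ = <⇒≱ b<c (AllPairs-⊆ nonInc (∷ˡ⁻ σ))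
... | two-left σ c∈Q = <⇒≯ c<a (All.lookup (All.lookup P≺Q (head-∈ σ)) c∈Q)
... | one-left _ σ = <⇒≯ b<c (AllPairs-⊆ dec σ)
... | all-right σ = <⇒≯ b<c (AllPairs-⊆ dec (∷ˡ⁻ σ))

mutual
  run-↭ : ∀ Ts xs st → run Ts xs st ↭ st ++ xs
  run-↭ Ts [] st = ↭-reflexive (sym (++-identityʳ st))
  run-↭ Ts (x ∷ xs) st = step-↭ Ts x xs st

  step-↭ : ∀ Ts x xs st → step Ts x xs st ↭ st ++ x ∷ xs
  step-↭ Ts x xs st with containsSome Ts (x ∷ st)
  ... | false = ↭-trans (run-↭ Ts xs (x ∷ st)) (↭-sym (shift x st xs))
  step-↭ Ts x xs [] | true = run-↭ Ts xs [ x ]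
  step-↭ Ts x xs (s ∷ st) | true = ↭-prep s (step-↭ Ts x xs st)

Blocks : Set
Blocks = List (ℕ × List ℕ)

flatten : Blocks → List ℕ
flatten [] = []
flatten ((m , b) ∷ D) = m ∷ b ++ flatten D

maxima : Blocks → List ℕ
maxima = map proj₁

-- The blocks M₁B₁⋯ of a left-to-right maxima decomposition, continuing
-- a prefix whose maxima are ms.
LtrBlocks : List ℕ → Blocks → Set
LtrBlocks ms [] = ⊤
LtrBlocks ms ((m , b) ∷ D) = All (_< m) ms × All (_< m) b × LtrBlocks (m ∷ ms) D

HeadAbove : ℕ → List ℕ → Set
HeadAbove m [] = ⊤
HeadAbove m (y ∷ _) = m < y

LtrBlocks⇒HeadAbove : ∀ {m ms} D → LtrBlocks (m ∷ ms) D → HeadAbove m (flatten D)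
LtrBlocks⇒HeadAbove [] _ = tt
LtrBlocks⇒HeadAbove (_ ∷ _) ((m<m′ ∷ _) , _) = m<m′

step-push : ∀ {Ts} x xs st → containsSome Ts (x ∷ st) ≡ false →
  step Ts x xs st ≡ run Ts xs (x ∷ st)
step-push _ _ _ eq rewrite eq = refl

step-pop : ∀ {Ts} x xs s st → containsSome Ts (x ∷ s ∷ st) ≡ true →
  step Ts x xs (s ∷ st) ≡ s ∷ step Ts x xs st
step-pop _ _ _ _ eq rewrite eq = refl

push-onto-decreasing : ∀ y xs {st} → Decreasing st → step T123-312 y xs st ≡ run T123-312 xs (y ∷ st)
push-onto-decreasing y xs {st} dec =
  step-push y xs st (containsSome-123-312≡false (∷-decreasing-avoids-123-312 y dec))

new-maximum-pops : ∀ {m ms y} r s → m < y → All (_< m) s →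
  run T123-312 (y ∷ r) (s ++ m ∷ ms) ≡ s ++ run T123-312 (y ∷ r) (m ∷ ms)
new-maximum-pops r [] _ _ = refl
new-maximum-pops {m} {ms} {y} r (a ∷ s) m<y (a<m ∷ s<m) = trans
  (step-pop y r a (s ++ m ∷ ms) (containsSome-123-312≡true
    (inj₂ (y , a , m , refl ∷ refl ∷ from∈ (∈-++⁺ʳ s (here refl)) , a<m , m<y))))
  (cong (a ∷_) (new-maximum-pops r s m<y s<m))

module BlockRun {m ms} (dec : Decreasing (m ∷ ms)) where

  step-in-block : ∀ {y} → y < m → ∀ s → All (_< m) s →
    ∃[ p ] ∃[ s′ ] All (_< m) s′ ×
      (∀ r → step T123-312 y r (s ++ m ∷ ms) ≡ p ++ run T123-312 r (y ∷ s′ ++ m ∷ ms))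
  step-in-block {y} _ [] _ =
    [] , [] , [] , λ r → push-onto-decreasing y r dec
  step-in-block {y} y<m (a ∷ s) (a<m ∷ s<m) with containsSome T123-312 (y ∷ a ∷ s ++ m ∷ ms)
  ... | false = [] , a ∷ s , a<m ∷ s<m , λ r → refl
  ... | true = let p , s′ , s′<m , step≡ = step-in-block y<m s s<m
               in a ∷ p , s′ , s′<m , λ r → cong (a ∷_) (step≡ r)

  run-block : ∀ b s → All (_< m) b → All (_< m) s →
    ∃[ g ] ∀ r → HeadAbove m r → run T123-312 (b ++ r) (s ++ m ∷ ms) ≡ g ++ run T123-312 r (m ∷ ms)
  run-block [] s _ s<m = s , λ { [] _ → refl ; (y ∷ r) m<y → new-maximum-pops r s m<y s<m }
  run-block (y ∷ b) s (y<m ∷ b<m) s<m =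
    let p , s′ , s′<m , step≡ = step-in-block y<m s s<m
        g , run≡ = run-block b (y ∷ s′) b<m (y<m ∷ s′<m)
    in p ++ g , λ r above → begin
      step T123-312 y (b ++ r) (s ++ m ∷ ms)             ≡⟨ step≡ (b ++ r) ⟩
      p ++ run T123-312 (b ++ r) (y ∷ s′ ++ m ∷ ms)      ≡⟨ cong (p ++_) (run≡ r above) ⟩
      p ++ g ++ run T123-312 r (m ∷ ms)                  ≡⟨ ++-assoc p g _ ⟨
      (p ++ g) ++ run T123-312 r (m ∷ ms)                ∎

run-blocks : ∀ {ms} D → Decreasing ms → LtrBlocks ms D →
  ∃[ C ] run T123-312 (flatten D) ms ≡ C ++ maxima D ʳ++ ms
run-blocks [] _ _ = [] , refl
run-blocks {ms} ((m , b) ∷ D) dec (ms<m , b<m , ltr) =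
  let g , run≡ = BlockRun.run-block (ms<m ∷ dec) b [] b<m []
      C , runD≡ = run-blocks D (ms<m ∷ dec) ltr
  in g ++ C , (begin
    step T123-312 m (b ++ flatten D) ms    ≡⟨ push-onto-decreasing m _ dec ⟩
    run T123-312 (b ++ flatten D) (m ∷ ms) ≡⟨ run≡ (flatten D) (LtrBlocks⇒HeadAbove D ltr) ⟩
    g ++ run T123-312 (flatten D) (m ∷ ms) ≡⟨ cong (g ++_) runD≡ ⟩
    g ++ C ++ maxima D ʳ++ (m ∷ ms)        ≡⟨ ++-assoc g C _ ⟨
    (g ++ C) ++ maxima D ʳ++ (m ∷ ms)      ∎)

mutual
  run₁₂ : List ℕ → List ℕ → List ℕ
  run₁₂ [] st = st
  run₁₂ (y ∷ b) st = step₁₂ y b st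

  step₁₂ : ℕ → List ℕ → List ℕ → List ℕ
  step₁₂ y b [] = run₁₂ b [ y ]
  step₁₂ y b (a ∷ st) = if y <ᵇ a then a ∷ step₁₂ y b st else run₁₂ b (y ∷ a ∷ st)

out₁₂ : List ℕ → List ℕ
out₁₂ b = run₁₂ b []

mutual
  run₁₂-↭ : ∀ b st → run₁₂ b st ↭ st ++ b
  run₁₂-↭ [] st = ↭-reflexive (sym (++-identityʳ st))
  run₁₂-↭ (y ∷ b) st = step₁₂-↭ y b st

  step₁₂-↭ : ∀ y b st → step₁₂ y b st ↭ st ++ y ∷ b
  step₁₂-↭ y b [] = run₁₂-↭ b [ y ]
  step₁₂-↭ y b (a ∷ st) with y <ᵇ a
  ... | true = ↭-prep a (step₁₂-↭ y b st)
  ... | false = ↭-trans (run₁₂-↭ b (y ∷ a ∷ st)) (↭-sym (shift y (a ∷ st) b))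

∈-out₁₂⁻ : ∀ {u} b → u ∈ out₁₂ b → u ∈ b
∈-out₁₂⁻ b = ∈-resp-↭ (run₁₂-↭ b [])

∈-out₁₂⁺ : ∀ {u} b → u ∈ b → u ∈ out₁₂ b
∈-out₁₂⁺ b = ∈-resp-↭ (↭-sym (run₁₂-↭ b []))

data MinimumSplit : List ℕ → Set where
  empty : MinimumSplit []
  split : ∀ L m R → All (m <_) L → All (m ≤_) R → MinimumSplit (L ++ m ∷ R)

minimumSplit : ∀ b → MinimumSplit b
minimumSplit [] = empty
minimumSplit (x ∷ xs) with minimumSplit xs
... | empty = split [] x [] [] []
... | split L m R m<L m≤R with x ≤? m
...   | yes x≤m = split [] x (L ++ m ∷ R) []
          (All.++⁺ (All.map (λ m<u → ≤-trans x≤m (<⇒≤ m<u)) m<L) (x≤m ∷ All.map (≤-trans x≤m) m≤R))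
...   | no x≰m = split (x ∷ L) m R (≰⇒> x≰m ∷ m<L) m≤R

-- Entering the first minimum m pops everything, and m then sits at the
-- bottom for the rest of the run.
module _ {m : ℕ} where

  step₁₂-pops-all : ∀ R st → All (m <_) st → step₁₂ m R st ≡ st ++ run₁₂ R [ m ]
  step₁₂-pops-all R [] _ = refl
  step₁₂-pops-all R (a ∷ st) (m<a ∷ m<st) rewrite to T-≡ (<⇒<ᵇ m<a) =
    cong (a ∷_) (step₁₂-pops-all R st m<st)

  mutual
    run₁₂-until-minimum : ∀ R L st → All (m <_) L → All (m <_) st →
      run₁₂ (L ++ m ∷ R) st ≡ run₁₂ L st ++ run₁₂ R [ m ]
    run₁₂-until-minimum R [] st _ m<st = step₁₂-pops-all R st m<st
    run₁₂-until-minimum R (y ∷ L) st (m<y ∷ m<L) m<st = step₁₂-until-minimum R y L st m<y m<L m<st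

    step₁₂-until-minimum : ∀ R y L st → m < y → All (m <_) L → All (m <_) st →
      step₁₂ y (L ++ m ∷ R) st ≡ step₁₂ y L st ++ run₁₂ R [ m ]
    step₁₂-until-minimum R y L [] m<y m<L _ = run₁₂-until-minimum R L [ y ] m<L (m<y ∷ [])
    step₁₂-until-minimum R y L (a ∷ st) m<y m<L (m<a ∷ m<st) with y <ᵇ a
    ... | true = cong (a ∷_) (step₁₂-until-minimum R y L st m<y m<L m<st)
    ... | false = run₁₂-until-minimum R L (y ∷ a ∷ st) m<L (m<y ∷ m<a ∷ m<st)

  mutual
    run₁₂-over-bottom : ∀ R st → All (m ≤_) R → run₁₂ R (st ++ [ m ]) ≡ run₁₂ R st ++ [ m ]
    run₁₂-over-bottom [] st _ = refl
    run₁₂-over-bottom (y ∷ R) st (m≤y ∷ m≤R) = step₁₂-over-bottom y R st m≤y m≤R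

    step₁₂-over-bottom : ∀ y R st → m ≤ y → All (m ≤_) R →
      step₁₂ y R (st ++ [ m ]) ≡ step₁₂ y R st ++ [ m ]
    step₁₂-over-bottom y R [] m≤y m≤R
      rewrite ¬T⇒≡false (≤⇒≯ m≤y ∘′ <ᵇ⇒< y m) = run₁₂-over-bottom R [ y ] m≤R
    step₁₂-over-bottom y R (a ∷ st) m≤y m≤R with y <ᵇ a
    ... | true = cong (a ∷_) (step₁₂-over-bottom y R st m≤y m≤R)
    ... | false = run₁₂-over-bottom R (y ∷ a ∷ st) m≤R

out₁₂-minimum : ∀ L m R → All (m <_) L → All (m ≤_) R →
  out₁₂ (L ++ m ∷ R) ≡ out₁₂ L ++ out₁₂ R ++ [ m ]
out₁₂-minimum L m R m<L m≤R = begin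
  run₁₂ (L ++ m ∷ R) []      ≡⟨ run₁₂-until-minimum R L [] m<L [] ⟩
  out₁₂ L ++ run₁₂ R [ m ]   ≡⟨ cong (out₁₂ L ++_) (run₁₂-over-bottom R [] m≤R) ⟩
  out₁₂ L ++ out₁₂ R ++ [ m ] ∎

_<ₗ_ : List ℕ → List ℕ → Set
xs <ₗ ys = length xs < length ys

<ₗ-wellFounded : WellFounded _<ₗ_
<ₗ-wellFounded = On.wellFounded length <-wellFounded

left-<ₗ : ∀ L {m : ℕ} R → L <ₗ (L ++ m ∷ R)
left-<ₗ L R = subst (length L <_) (sym (length-++ L)) (m<m+n (length L) z<s)

right-<ₗ : ∀ L {m : ℕ} R → R <ₗ (L ++ m ∷ R)
right-<ₗ L R = subst (length R <_) (sym (length-++ L)) (m≤n+m (suc (length R)) (length L))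

⊆-++ˡ : ∀ {xs : List ℕ} ys → xs ⊆ xs ++ ys
⊆-++ˡ ys = ++⁺ʳ ys ⊆-refl

⊆-++ʳ : ∀ xs {ys : List ℕ} → ys ⊆ xs ++ ys
⊆-++ʳ xs = ++⁺ˡ xs ⊆-refl

-- As out₁₂ (L ++ m ∷ R) = out₁₂ L ++ out₁₂ R ++ [ m ], an ascent x y lies in
-- one side or has x ∈ L and y ∈ R, and then x m y is a 213.
out₁₂-ascent⇒213 : ∀ b → Acc _<ₗ_ b → ∀ {x y} → (x ∷ y ∷ []) ⊆ out₁₂ b → x < y → Occ213 b
out₁₂-ascent⇒213 b (acc rec) {x} {y} τ x<y with minimumSplit b
... | split L m R m<L m≤R with split₂ (out₁₂ L) (subst ((x ∷ y ∷ []) ⊆_) (out₁₂-minimum L m R m<L m≤R) τ)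
...   | both-left σ = Occ₃-⊆ (⊆-++ˡ (m ∷ R)) (out₁₂-ascent⇒213 L (rec (left-<ₗ L R)) σ x<y)
...   | across x∈ y∈ with ∈-++⁻ (out₁₂ R) y∈
...     | inj₁ y∈R = x , m , y , ++⁺ (from∈ (∈-out₁₂⁻ L x∈)) (refl ∷ from∈ (∈-out₁₂⁻ R y∈R)) ,
                     All.lookup m<L (∈-out₁₂⁻ L x∈) , x<y
...     | inj₂ (here refl) = contradiction (All.lookup m<L (∈-out₁₂⁻ L x∈)) (<-asym x<y)
out₁₂-ascent⇒213 b (acc rec) {x} {y} τ x<y | split L m R m<L m≤R | both-right σ with split₂ (out₁₂ R) σ
... | both-left ρ = Occ₃-⊆ (⊆-++ʳ L) (Occ₃-⊆ (m ∷ʳ ⊆-refl) (out₁₂-ascent⇒213 R (rec (right-<ₗ L R)) ρ x<y))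
... | across x∈ (here refl) = contradiction (All.lookup m≤R (∈-out₁₂⁻ R x∈)) (<⇒≱ x<y)
... | both-right (_ ∷ʳ ())
... | both-right (refl ∷ ())

-- A 213 x v y straddling the minimum m of b gives the 231 x y m in out₁₂ b.
213⇒out₁₂-231 : ∀ b → Acc _<ₗ_ b → Occ213 b → Occ231 (out₁₂ b)
213⇒out₁₂-231 b (acc rec) (x , v , y , τ , v<x , x<y) with minimumSplit b
... | split L m R m<L m≤R = subst Occ231 (sym (out₁₂-minimum L m R m<L m≤R)) (occ (split₃ L τ))
  where
  straddling : x ∈ L → y ∈ m ∷ R → Occ231 (out₁₂ L ++ out₁₂ R ++ [ m ])
  straddling x∈L (here refl) = contradiction (All.lookup m<L x∈L) (<-asym x<y)
  straddling x∈L (there y∈R) =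
    x , y , m , ++⁺ (from∈ (∈-out₁₂⁺ L x∈L)) (++⁺ (from∈ (∈-out₁₂⁺ R y∈R)) ⊆-refl) ,
    All.lookup m<L x∈L , x<y

  occ : Split₃ x v y L (m ∷ R) → Occ231 (out₁₂ L ++ out₁₂ R ++ [ m ])
  occ (all-left σ) = Occ₃-⊆ (⊆-++ˡ _) (213⇒out₁₂-231 L (rec (left-<ₗ L R)) (x , v , y , σ , v<x , x<y))
  occ (two-left σ y∈) = straddling (head-∈ σ) y∈
  occ (one-left x∈L σ) = straddling x∈L (head-∈ (∷ˡ⁻ σ))
  occ (all-right (refl ∷ σ)) = contradiction (All.lookup m≤R (head-∈ σ)) (<⇒≱ v<x)
  occ (all-right (_ ∷ʳ σ)) = Occ₃-⊆ (⊆-++ʳ (out₁₂ L)) (Occ₃-⊆ (⊆-++ˡ _)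
    (213⇒out₁₂-231 R (rec (right-<ₗ L R)) (x , v , y , σ , v<x , x<y)))

Separated : ℕ → Blocks → Set
Separated β = All λ (m , b) → All (_< β) b × β ≤ m

sortedBlocks : Blocks → List ℕ
sortedBlocks = concatMap (out₁₂ ∘ proj₂)

-- With the block entries below every stacked maximum, an entry y meeting a
-- larger top a forms the 123 y a m and pops it, as the {12}-stack would;
-- otherwise the block part stays non-increasing and y is pushed.
module SeparatedBlockRun {β m ms} (dec : Decreasing (m ∷ ms)) (β≤ : All (β ≤_) (m ∷ ms)) where

  below-m : ∀ {s} → All (_< β) s → All (_< m) s
  below-m = All.map λ u<β → <-≤-trans u<β (All.head β≤)

  mutual
    run-block : ∀ b s → All (_< β) b → NonIncreasing s → All (_< β) s → ∀ r → HeadAbove m r →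
      run T123-312 (b ++ r) (s ++ m ∷ ms) ≡ run₁₂ b s ++ run T123-312 r (m ∷ ms)
    run-block [] s _ _ _ [] _ = refl
    run-block [] s _ _ s<β (y ∷ r) m<y = new-maximum-pops r s m<y (below-m s<β)
    run-block (y ∷ b) s (y<β ∷ b<β) s↘ s<β r above = step-block y<β b b<β s s↘ s<β r above

    step-block : ∀ {y} → y < β → ∀ b → All (_< β) b → ∀ s → NonIncreasing s → All (_< β) s →
      ∀ r → HeadAbove m r →
      step T123-312 y (b ++ r) (s ++ m ∷ ms) ≡ step₁₂ y b s ++ run T123-312 r (m ∷ ms)
    step-block {y} y<β b b<β [] _ _ r above = trans
      (push-onto-decreasing y (b ++ r) dec)
      (run-block b [ y ] b<β ([] ∷ []) (y<β ∷ []) r above)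
    step-block {y} y<β b b<β (a ∷ s) (a≥s ∷ s↘) (a<β ∷ s<β) r above with y <ᵇ a in y<ᵇa
    ... | true = trans
      (step-pop y (b ++ r) a (s ++ m ∷ ms) (containsSome-123-312≡true (inj₁
        (y , a , m , refl ∷ refl ∷ from∈ (∈-++⁺ʳ s (here refl)) ,
         <ᵇ⇒< y a (from T-≡ y<ᵇa) , <-≤-trans a<β (All.head β≤)))))
      (cong (a ∷_) (step-block y<β b b<β s s↘ s<β r above))
    ... | false = trans
      (step-push y (b ++ r) (a ∷ s ++ m ∷ ms) (containsSome-123-312≡false
        (++-avoids-123-312 (y ∷ a ∷ s) y∷a∷s↘ dec
          (All.map (λ u<β → All.map (<-≤-trans u<β) β≤) (y<β ∷ a<β ∷ s<β)))))
      (run-block b (y ∷ a ∷ s) b<β y∷a∷s↘ (y<β ∷ a<β ∷ s<β) r above)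
      where
      a≤y : a ≤ y
      a≤y = ≮⇒≥ λ y<a → subst T y<ᵇa (<⇒<ᵇ y<a)
      y∷a∷s↘ : NonIncreasing (y ∷ a ∷ s)
      y∷a∷s↘ = (a≤y ∷ All.map (λ u≤a → ≤-trans u≤a a≤y) a≥s) ∷ a≥s ∷ s↘

run-separated-blocks : ∀ {β ms} D → Decreasing ms → All (β ≤_) ms → LtrBlocks ms D → Separated β D →
  run T123-312 (flatten D) ms ≡ sortedBlocks D ++ maxima D ʳ++ ms
run-separated-blocks [] _ _ _ _ = refl
run-separated-blocks {β} {ms} ((m , b) ∷ D) dec β≤ms (ms<m , _ , ltr) ((b<β , β≤m) ∷ sep) = begin
  step T123-312 m (b ++ flatten D) ms
    ≡⟨ push-onto-decreasing m _ dec ⟩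
  run T123-312 (b ++ flatten D) (m ∷ ms)
    ≡⟨ SeparatedBlockRun.run-block (ms<m ∷ dec) (β≤m ∷ β≤ms) b [] b<β [] []
         (flatten D) (LtrBlocks⇒HeadAbove D ltr) ⟩
  out₁₂ b ++ run T123-312 (flatten D) (m ∷ ms)
    ≡⟨ cong (out₁₂ b ++_) (run-separated-blocks D (ms<m ∷ dec) (β≤m ∷ β≤ms) ltr sep) ⟩
  out₁₂ b ++ sortedBlocks D ++ maxima D ʳ++ (m ∷ ms)
    ≡⟨ ++-assoc (out₁₂ b) (sortedBlocks D) _ ⟨
  (out₁₂ b ++ sortedBlocks D) ++ maxima D ʳ++ (m ∷ ms) ∎

head-≤ : ∀ {a st b} → NonDecreasing (a ∷ st) → b ∈ a ∷ st → a ≤ b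
head-≤ _ (here refl) = ≤-refl
head-≤ (a≤st ∷ _) (there b∈st) = All.lookup a≤st b∈st

pop₂₁⇒< : ∀ x {a st} → NonDecreasing (a ∷ st) → containsSome T21 (x ∷ a ∷ st) ≡ true → a < x
pop₂₁⇒< x {a} {st} st↗ eq with to (T-containsSome-21⇔ {x ∷ a ∷ st}) (from T-≡ eq)
... | _ , _ , _ ∷ʳ τ , v<u = contradiction (AllPairs-⊆ st↗ τ) (<⇒≱ v<u)
... | _ , _ , refl ∷ τ , v<x = ≤-<-trans (head-≤ st↗ (head-∈ τ)) v<x

push₂₁⇒≤ : ∀ x a st → containsSome T21 (x ∷ a ∷ st) ≡ false → x ≤ a
push₂₁⇒≤ x a st eq = ≮⇒≥ λ a<x →
  subst T eq (from T-containsSome-21⇔ (x , a , refl ∷ refl ∷ minimum st , a<x))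

∷-nonDecreasing : ∀ {x a st} → x ≤ a → NonDecreasing (a ∷ st) → NonDecreasing (x ∷ a ∷ st)
∷-nonDecreasing x≤a st↗@(a≤st ∷ _) = (x≤a ∷ All.map (≤-trans x≤a) a≤st) ∷ st↗

-- The 2 of a 231 is already on the stack while its 3 and 1 are still to come.
Pending231 : List ℕ → List ℕ → Set
Pending231 st xs = ∃[ a ] ∃[ y ] ∃[ z ] a ∈ st × (y ∷ z ∷ []) ⊆ xs × z < a × a < y

mutual
  run₂₁-sorted : ∀ xs st → NonDecreasing st → ¬ Occ231 xs → ¬ Pending231 st xs →
    NonDecreasing (run T21 xs st)
  run₂₁-sorted [] st st↗ _ _ = st↗
  run₂₁-sorted (x ∷ xs) st st↗ no231 noPending = step₂₁-sorted x xs st st↗ no231 noPending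

  step₂₁-sorted : ∀ x xs st → NonDecreasing st → ¬ Occ231 (x ∷ xs) → ¬ Pending231 st (x ∷ xs) →
    NonDecreasing (step T21 x xs st)
  step₂₁-sorted x xs [] _ no231 _ =
    run₂₁-sorted xs [ x ] ([] ∷ []) (no231 ∘ Occ₃-⊆ (x ∷ʳ ⊆-refl))
      λ { (_ , y , z , here refl , τ , z<x , x<y) → no231 (x , y , z , refl ∷ τ , z<x , x<y) }
  step₂₁-sorted x xs (a ∷ st) st↗ no231 noPending with containsSome T21 (x ∷ a ∷ st) in eq
  ... | false = run₂₁-sorted xs (x ∷ a ∷ st) (∷-nonDecreasing (push₂₁⇒≤ x a st eq) st↗)
      (no231 ∘ Occ₃-⊆ (x ∷ʳ ⊆-refl)) λ
        { (_ , y , z , here refl , τ , r) → no231 (x , y , z , refl ∷ τ , r)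
        ; (b , y , z , there b∈ , τ , r) → noPending (b , y , z , b∈ , x ∷ʳ τ , r) }
  ... | true = All-resp-↭ (↭-sym (step-↭ T21 x xs st)) (All.++⁺ (AllPairs.head st↗) (<⇒≤ a<x ∷ a≤xs))
      ∷ step₂₁-sorted x xs st (AllPairs.tail st↗) no231
          λ (b , y , z , b∈ , r) → noPending (b , y , z , there b∈ , r)
    where
    a<x : a < x
    a<x = pop₂₁⇒< x st↗ eq
    a≤xs : All (a ≤_) xs
    a≤xs = All.tabulate λ {z} z∈xs → ≮⇒≥ λ z<a →
      noPending (a , x , z , here refl , refl ∷ from∈ z∈xs , z<a , a<x)

mutual
  run₂₁-descent : ∀ xs st → NonDecreasing st → Occ231 xs ⊎ Pending231 st xs → Occ21 (run T21 xs st)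
  run₂₁-descent [] st _ (inj₁ (_ , _ , _ , () , _))
  run₂₁-descent [] st _ (inj₂ (_ , _ , _ , _ , () , _))
  run₂₁-descent (x ∷ xs) st st↗ bad = step₂₁-descent x xs st st↗ bad

  step₂₁-descent : ∀ x xs st → NonDecreasing st → Occ231 (x ∷ xs) ⊎ Pending231 st (x ∷ xs) →
    Occ21 (step T21 x xs st)
  step₂₁-descent x xs [] _ (inj₁ (_ , y , z , refl ∷ τ , r)) =
    run₂₁-descent xs [ x ] ([] ∷ []) (inj₂ (x , y , z , here refl , τ , r))
  step₂₁-descent x xs [] _ (inj₁ (a , y , z , _ ∷ʳ τ , r)) =
    run₂₁-descent xs [ x ] ([] ∷ []) (inj₁ (a , y , z , τ , r))
  step₂₁-descent x xs (a ∷ st) st↗ bad with containsSome T21 (x ∷ a ∷ st) in eq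
  ... | false = run₂₁-descent xs (x ∷ a ∷ st) (∷-nonDecreasing x≤a st↗) (shift-bad bad)
    where
    x≤a = push₂₁⇒≤ x a st eq
    shift-bad : Occ231 (x ∷ xs) ⊎ Pending231 (a ∷ st) (x ∷ xs) → Occ231 xs ⊎ Pending231 (x ∷ a ∷ st) xs
    shift-bad (inj₁ (_ , y , z , refl ∷ τ , r)) = inj₂ (x , y , z , here refl , τ , r)
    shift-bad (inj₁ (b , y , z , _ ∷ʳ τ , r)) = inj₁ (b , y , z , τ , r)
    shift-bad (inj₂ (b , y , z , b∈ , refl ∷ τ , _ , b<x)) =
      contradiction (≤-trans x≤a (head-≤ st↗ b∈)) (<⇒≱ b<x)
    shift-bad (inj₂ (b , y , z , b∈ , _ ∷ʳ τ , r)) = inj₂ (b , y , z , there b∈ , τ , r)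
  ... | true = popped bad
    where
    lift : Occ21 (step T21 x xs st) → Occ21 (a ∷ step T21 x xs st)
    lift (u , v , τ , v<u) = u , v , a ∷ʳ τ , v<u
    popped : Occ231 (x ∷ xs) ⊎ Pending231 (a ∷ st) (x ∷ xs) → Occ21 (a ∷ step T21 x xs st)
    popped (inj₂ (_ , y , z , here refl , τ , z<a , _)) =
      a , z , refl ∷ from∈ (∈-resp-↭ (↭-sym (step-↭ T21 x xs st)) (∈-++⁺ʳ st (head-∈ (∷ˡ⁻ τ)))) , z<a
    popped (inj₂ (b , y , z , there b∈ , r)) =
      lift (step₂₁-descent x xs st (AllPairs.tail st↗) (inj₂ (b , y , z , b∈ , r)))
    popped (inj₁ o) = lift (step₂₁-descent x xs st (AllPairs.tail st↗) (inj₁ o))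

nonDecreasing-↭⇒head≡ : ∀ {x y xs ys} → NonDecreasing (x ∷ xs) → NonDecreasing (y ∷ ys) →
  x ∷ xs ↭ y ∷ ys → x ≡ y
nonDecreasing-↭⇒head≡ xs↗ ys↗ p with ∈-resp-↭ p (here refl) | ∈-resp-↭ (↭-sym p) (here refl)
... | here x≡y | _ = x≡y
... | _ | here y≡x = sym y≡x
... | there x∈ys | there y∈xs = ≤-antisym (head-≤ xs↗ (there y∈xs)) (head-≤ ys↗ (there x∈ys))

nonDecreasing-↭⇒≡ : ∀ {xs ys} → NonDecreasing xs → NonDecreasing ys → xs ↭ ys → xs ≡ ys
nonDecreasing-↭⇒≡ {[]} {[]} _ _ _ = refl
nonDecreasing-↭⇒≡ {[]} {_ ∷ _} _ _ p with () ← ↭-length p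
nonDecreasing-↭⇒≡ {_ ∷ _} {[]} _ _ p with () ← ↭-length p
nonDecreasing-↭⇒≡ {x ∷ xs} {y ∷ ys} xs↗ ys↗ p with refl ← nonDecreasing-↭⇒head≡ xs↗ ys↗ p =
  cong (x ∷_) (nonDecreasing-↭⇒≡ (AllPairs.tail xs↗) (AllPairs.tail ys↗) (drop-∷ p))

idPerm-increasing : ∀ n → AllPairs _<_ (idPerm n)
idPerm-increasing n = AllPairs.applyUpTo⁺₁ suc n λ i<j _ → s<s i<j

out₂₁-sorts⇔avoids-231 : ∀ {n o} → o ↭ idPerm n → (out T21 o ≡ idPerm n) ⇔ (¬ Occ231 o)
out₂₁-sorts⇔avoids-231 {n} {o} o↭ = mk⇔
  (λ sorted occ → let _ , _ , τ , v<u = subst Occ21 sorted (run₂₁-descent o [] [] (inj₁ occ))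
                  in <-asym v<u (AllPairs-⊆ (idPerm-increasing n) τ))
  (λ no231 → nonDecreasing-↭⇒≡
    (run₂₁-sorted o [] [] no231 λ { (_ , _ , _ , () , _) })
    (AllPairs.map <⇒≤ (idPerm-increasing n))
    (↭-trans (run-↭ T21 o []) o↭))

flatten-ltrGo : ∀ m blk ys → flatten (ltrGo m blk ys) ≡ m ∷ blk ++ ys
flatten-ltrGo m blk [] = refl
flatten-ltrGo m blk (y ∷ ys) with m <ᵇ y
... | true = cong (λ l → m ∷ blk ++ l) (flatten-ltrGo y [] ys)
... | false = trans (flatten-ltrGo m (blk ++ [ y ]) ys) (cong (m ∷_) (++-assoc blk [ y ] ys))

flatten-ltrDecomp : ∀ π → flatten (ltrDecomp π) ≡ π
flatten-ltrDecomp [] = refl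
flatten-ltrDecomp (x ∷ xs) = flatten-ltrGo x [] xs

ltrGo-LtrBlocks : ∀ {m ms blk ys} → All (_< m) ms → All (_< m) blk → Unique (m ∷ ys) →
  LtrBlocks ms (ltrGo m blk ys)
ltrGo-LtrBlocks {ys = []} ms<m blk<m _ = ms<m , blk<m , tt
ltrGo-LtrBlocks {m} {ys = y ∷ ys} ms<m blk<m ((m≢y ∷ m≢ys) ∷ uniq) with m <ᵇ y in m<ᵇy
... | true = ms<m , blk<m , ltrGo-LtrBlocks (m<y ∷ All.map (λ u<m → <-trans u<m m<y) ms<m) [] uniq
  where m<y = <ᵇ⇒< m y (from T-≡ m<ᵇy)
... | false = ltrGo-LtrBlocks ms<m (All.++⁺ blk<m (y<m ∷ [])) (m≢ys ∷ AllPairs.tail uniq)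
  where y<m = ≤∧≢⇒< (≮⇒≥ λ m<y → subst T m<ᵇy (<⇒<ᵇ m<y)) (m≢y ∘ sym)

ltrDecomp-LtrBlocks : ∀ {π} → Unique π → LtrBlocks [] (ltrDecomp π)
ltrDecomp-LtrBlocks {[]} _ = tt
ltrDecomp-LtrBlocks {x ∷ xs} uniq = ltrGo-LtrBlocks [] [] uniq

AllPairs-lookup : ∀ {A : Set} {R : A → A → Set} {xs} → AllPairs R xs →
  ∀ {i j} → i Fin.< j → R (lookup xs i) (lookup xs j)
AllPairs-lookup (r ∷ _) {zero} {suc j} _ = All.lookup r (∈-lookup j)
AllPairs-lookup (_ ∷ rs) {suc i} {suc j} (s<s i<j) = AllPairs-lookup rs i<j

maxAt : (D : Blocks) → Fin (length D) → ℕ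
maxAt D i = proj₁ (lookup D i)

blockAt : (D : Blocks) → Fin (length D) → List ℕ
blockAt D i = proj₂ (lookup D i)

LtrBlocks-above : ∀ {ms} D → LtrBlocks ms D → ∀ {u} → u ∈ ms → All (λ p → u < proj₁ p) D
LtrBlocks-above [] _ _ = []
LtrBlocks-above ((m , b) ∷ D) (ms<m , _ , ltr) u∈ms =
  All.lookup ms<m u∈ms ∷ LtrBlocks-above D ltr (there u∈ms)

LtrBlocks-increasing : ∀ {ms} D → LtrBlocks ms D → AllPairs (λ p q → proj₁ p < proj₁ q) D
LtrBlocks-increasing [] _ = []
LtrBlocks-increasing ((m , b) ∷ D) (_ , _ , ltr) = LtrBlocks-above D ltr (here refl) ∷ LtrBlocks-increasing D ltr

LtrBlocks-maxima-< : ∀ {ms} D → LtrBlocks ms D → ∀ {i j} → i Fin.< j → maxAt D i < maxAt D j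
LtrBlocks-maxima-< D ltr = AllPairs-lookup (LtrBlocks-increasing D ltr)

LtrBlocks-block-< : ∀ {ms} D → LtrBlocks ms D → ∀ i {u} → u ∈ blockAt D i → u < maxAt D i
LtrBlocks-block-< ((m , b) ∷ D) (_ , b<m , _) zero u∈b = All.lookup b<m u∈b
LtrBlocks-block-< ((m , b) ∷ D) (_ , _ , ltr) (suc i) u∈ = LtrBlocks-block-< D ltr i u∈

LtrBlocks-ʳ++-decreasing : ∀ {ms} D → Decreasing ms → LtrBlocks ms D → Decreasing (maxima D ʳ++ ms)
LtrBlocks-ʳ++-decreasing [] dec _ = dec
LtrBlocks-ʳ++-decreasing ((m , b) ∷ D) dec (ms<m , _ , ltr) = LtrBlocks-ʳ++-decreasing D (ms<m ∷ dec) ltr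

maxAt-∈-flatten : ∀ D i → maxAt D i ∈ flatten D
maxAt-∈-flatten ((m , b) ∷ D) zero = here refl
maxAt-∈-flatten ((m , b) ∷ D) (suc i) = there (∈-++⁺ʳ b (maxAt-∈-flatten D i))

blockAt-∈-flatten : ∀ D i {u} → u ∈ blockAt D i → u ∈ flatten D
blockAt-∈-flatten ((m , b) ∷ D) zero u∈ = there (∈-++⁺ˡ u∈)
blockAt-∈-flatten ((m , b) ∷ D) (suc i) u∈ = there (∈-++⁺ʳ b (blockAt-∈-flatten D i u∈))

∈-flatten⁻ : ∀ D {u} → u ∈ flatten D → (∃[ i ] u ≡ maxAt D i) ⊎ (∃[ i ] u ∈ blockAt D i)
∈-flatten⁻ ((m , b) ∷ D) (here u≡m) = inj₁ (zero , u≡m)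
∈-flatten⁻ ((m , b) ∷ D) (there u∈) with ∈-++⁻ b u∈
... | inj₁ u∈b = inj₂ (zero , u∈b)
... | inj₂ u∈D with ∈-flatten⁻ D u∈D
...   | inj₁ (i , u≡) = inj₁ (suc i , u≡)
...   | inj₂ (i , u∈′) = inj₂ (suc i , u∈′)

Unique-++-disjoint : ∀ xs {ys} {u v : ℕ} → Unique (xs ++ ys) → u ∈ xs → v ∈ ys → u ≢ v
Unique-++-disjoint (x ∷ xs) (x≢ ∷ _) (here refl) v∈ys = All.lookup x≢ (∈-++⁺ʳ xs v∈ys)
Unique-++-disjoint (x ∷ xs) (_ ∷ uniq) (there u∈xs) v∈ys = Unique-++-disjoint xs uniq u∈xs v∈ys

Unique-++ʳ : ∀ xs {ys : List ℕ} → Unique (xs ++ ys) → Unique ys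
Unique-++ʳ [] uniq = uniq
Unique-++ʳ (x ∷ xs) (_ ∷ uniq) = Unique-++ʳ xs uniq

block-≢-max : ∀ D → Unique (flatten D) → ∀ i k {u} → u ∈ blockAt D i → u ≢ maxAt D k
block-≢-max ((m , b) ∷ D) (m≢ ∷ _) zero zero u∈b u≡m = All.lookup m≢ (∈-++⁺ˡ u∈b) (sym u≡m)
block-≢-max ((m , b) ∷ D) (_ ∷ uniq) zero (suc k) u∈b = Unique-++-disjoint b uniq u∈b (maxAt-∈-flatten D k)
block-≢-max ((m , b) ∷ D) (m≢ ∷ _) (suc i) zero u∈ u≡m =
  All.lookup m≢ (∈-++⁺ʳ b (blockAt-∈-flatten D i u∈)) (sym u≡m)
block-≢-max ((m , b) ∷ D) (_ ∷ uniq) (suc i) (suc k) = block-≢-max D (Unique-++ʳ b uniq) i k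

⊆-ʳ++ : ∀ xs {ws ys : List ℕ} → ws ⊆ ys → ws ⊆ xs ʳ++ ys
⊆-ʳ++ [] τ = τ
⊆-ʳ++ (x ∷ xs) τ = ⊆-ʳ++ xs (x ∷ʳ τ)

∈-ʳ++-⊆ : ∀ xs {u : ℕ} {vs ys} → u ∈ xs → vs ⊆ ys → (u ∷ vs) ⊆ xs ʳ++ ys
∈-ʳ++-⊆ (x ∷ xs) (here refl) τ = ⊆-ʳ++ xs (refl ∷ τ)
∈-ʳ++-⊆ (x ∷ xs) (there u∈) τ = ∈-ʳ++-⊆ xs u∈ (x ∷ʳ τ)

maxAt-∈-maxima : ∀ D i → maxAt D i ∈ maxima D
maxAt-∈-maxima ((m , b) ∷ D) zero = here refl
maxAt-∈-maxima ((m , b) ∷ D) (suc i) = there (maxAt-∈-maxima D i)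

maxima-ʳ++-⊆ : ∀ D ms {i j} → j Fin.< i → (maxAt D i ∷ maxAt D j ∷ []) ⊆ maxima D ʳ++ ms
maxima-ʳ++-⊆ ((m , b) ∷ D) ms {suc i} {zero} _ = ∈-ʳ++-⊆ (maxima D) (maxAt-∈-maxima D i) (refl ∷ minimum ms)
maxima-ʳ++-⊆ ((m , b) ∷ D) ms {suc i} {suc j} (s<s j<i) = maxima-ʳ++-⊆ D (m ∷ ms) j<i

∈-maxima-ʳ++⁻ : ∀ D ms {u} → u ∈ maxima D ʳ++ ms → u ∈ ms ⊎ ∃[ i ] u ≡ maxAt D i
∈-maxima-ʳ++⁻ [] ms u∈ = inj₁ u∈
∈-maxima-ʳ++⁻ ((m , b) ∷ D) ms u∈ with ∈-maxima-ʳ++⁻ D (m ∷ ms) u∈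
... | inj₁ (here u≡m) = inj₂ (zero , u≡m)
... | inj₁ (there u∈ms) = inj₁ u∈ms
... | inj₂ (i , u≡) = inj₂ (suc i , u≡)

module _ {A : Set} (f : A → List ℕ) where

  concatMap-⊆ : ∀ D i {ws} → ws ⊆ f (lookup D i) → ws ⊆ concatMap f D
  concatMap-⊆ (p ∷ D) zero τ = ++⁺ʳ (concatMap f D) τ
  concatMap-⊆ (p ∷ D) (suc i) τ = ++⁺ˡ (f p) (concatMap-⊆ D i τ)

  concatMap-⊆₂ : ∀ D {i j x ws} → i Fin.< j → x ∈ f (lookup D i) → ws ⊆ f (lookup D j) →
    (x ∷ ws) ⊆ concatMap f D
  concatMap-⊆₂ (p ∷ D) {zero} {suc j} _ x∈ τ = ++⁺ (from∈ x∈) (concatMap-⊆ D j τ)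
  concatMap-⊆₂ (p ∷ D) {suc i} {suc j} (s<s i<j) x∈ τ = ++⁺ˡ (f p) (concatMap-⊆₂ D i<j x∈ τ)

  concatMap-⊆₃ : ∀ D {i j k x y z} → i Fin.< j → j Fin.< k →
    x ∈ f (lookup D i) → y ∈ f (lookup D j) → z ∈ f (lookup D k) → (x ∷ y ∷ z ∷ []) ⊆ concatMap f D
  concatMap-⊆₃ (p ∷ D) {zero} {suc j} {suc k} _ (s<s j<k) x∈ y∈ z∈ =
    ++⁺ (from∈ x∈) (concatMap-⊆₂ D j<k y∈ (from∈ z∈))
  concatMap-⊆₃ (p ∷ D) {suc i} {suc j} {suc k} (s<s i<j) (s<s j<k) x∈ y∈ z∈ =
    ++⁺ˡ (f p) (concatMap-⊆₃ D i<j j<k x∈ y∈ z∈)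

  ∈-concatMap⁻ : ∀ D {u} → u ∈ concatMap f D → ∃[ i ] u ∈ f (lookup D i)
  ∈-concatMap⁻ (p ∷ D) u∈ with ∈-++⁻ (f p) u∈
  ... | inj₁ u∈p = zero , u∈p
  ... | inj₂ u∈D = let i , u∈′ = ∈-concatMap⁻ D u∈D in suc i , u∈′

  data Spread₂ (D : List A) (x y : ℕ) : Set where
    one-block  : ∀ i → (x ∷ y ∷ []) ⊆ f (lookup D i) → Spread₂ D x y
    two-blocks : ∀ {i j} → i Fin.< j → x ∈ f (lookup D i) → y ∈ f (lookup D j) → Spread₂ D x y

  spread₂ : ∀ D {x y} → (x ∷ y ∷ []) ⊆ concatMap f D → Spread₂ D x y
  spread₂ (p ∷ D) τ with split₂ (f p) τ
  ... | both-left σ = one-block zero σ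
  ... | across x∈ y∈ = let j , y∈′ = ∈-concatMap⁻ D y∈ in two-blocks {j = suc j} z<s x∈ y∈′
  ... | both-right σ with spread₂ D σ
  ...   | one-block i σ′ = one-block (suc i) σ′
  ...   | two-blocks i<j x∈ y∈ = two-blocks (s<s i<j) x∈ y∈

  data Spread₃ (D : List A) (x y z : ℕ) : Set where
    one-block    : ∀ i → (x ∷ y ∷ z ∷ []) ⊆ f (lookup D i) → Spread₃ D x y z
    first-two    : ∀ {i k} → i Fin.< k →
      (x ∷ y ∷ []) ⊆ f (lookup D i) → z ∈ f (lookup D k) → Spread₃ D x y z
    last-two     : ∀ {i j} → i Fin.< j →
      x ∈ f (lookup D i) → (y ∷ z ∷ []) ⊆ f (lookup D j) → Spread₃ D x y z
    three-blocks : ∀ {i j k} → i Fin.< j → j Fin.< k →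
      x ∈ f (lookup D i) → y ∈ f (lookup D j) → z ∈ f (lookup D k) → Spread₃ D x y z

  spread₃ : ∀ D {x y z} → (x ∷ y ∷ z ∷ []) ⊆ concatMap f D → Spread₃ D x y z
  spread₃ (p ∷ D) τ with split₃ (f p) τ
  ... | all-left σ = one-block zero σ
  ... | two-left σ z∈ = let k , z∈′ = ∈-concatMap⁻ D z∈ in first-two {k = suc k} z<s σ z∈′
  ... | one-left x∈ σ with spread₂ D σ
  ...   | one-block j σ′ = last-two {j = suc j} z<s x∈ σ′
  ...   | two-blocks j<k y∈ z∈ = three-blocks z<s (s<s j<k) x∈ y∈ z∈
  spread₃ (p ∷ D) τ | all-right σ with spread₃ D σ
  ... | one-block i σ′ = one-block (suc i) σ′
  ... | first-two i<k σ′ z∈ = first-two (s<s i<k) σ′ z∈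
  ... | last-two i<j x∈ σ′ = last-two (s<s i<j) x∈ σ′
  ... | three-blocks i<j j<k x∈ y∈ z∈ = three-blocks (s<s i<j) (s<s j<k) x∈ y∈ z∈

take-++-exact : ∀ (xs ys : List ℕ) {n} → length xs ≡ n → take n (xs ++ ys) ≡ xs
take-++-exact [] ys refl = refl
take-++-exact (x ∷ xs) ys refl = cong (x ∷_) (take-++-exact xs ys refl)

drop-++-exact : ∀ (xs ys : List ℕ) {n} k → length xs ≡ n → drop (n + k) (xs ++ ys) ≡ drop k ys
drop-++-exact [] ys k refl = refl
drop-++-exact (x ∷ xs) ys k refl = drop-++-exact xs ys k refl

length-out₁₂ : ∀ b → length (out₁₂ b) ≡ length b
length-out₁₂ b = ↭-length (run₁₂-↭ b [])

blockOffset : (D : Blocks) → Fin (length D) → ℕ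
blockOffset D j = sum (map (λ p → length (proj₂ p)) (take (toℕ j) D))

sortedBlocks-window : ∀ D j R →
  take (length (blockAt D j)) (drop (blockOffset D j) (sortedBlocks D ++ R)) ≡ out₁₂ (blockAt D j)
sortedBlocks-window ((m , b) ∷ D) zero R =
  trans (cong (take (length b)) (++-assoc (out₁₂ b) (sortedBlocks D) R))
        (take-++-exact (out₁₂ b) _ (length-out₁₂ b))
sortedBlocks-window ((m , b) ∷ D) (suc j) R = begin
  take (length (blockAt D j)) (drop (length b + blockOffset D j) ((out₁₂ b ++ sortedBlocks D) ++ R))
    ≡⟨ cong (λ l → take (length (blockAt D j)) (drop (length b + blockOffset D j) l))
            (++-assoc (out₁₂ b) (sortedBlocks D) R) ⟩
  take (length (blockAt D j)) (drop (length b + blockOffset D j) (out₁₂ b ++ sortedBlocks D ++ R))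
    ≡⟨ cong (take (length (blockAt D j))) (drop-++-exact (out₁₂ b) _ (blockOffset D j) (length-out₁₂ b)) ⟩
  take (length (blockAt D j)) (drop (blockOffset D j) (sortedBlocks D ++ R))
    ≡⟨ sortedBlocks-window D j R ⟩
  out₁₂ (blockAt D j) ∎

All-lookup⁻ : ∀ {A : Set} {P : A → Set} xs → (∀ i → P (lookup xs i)) → All P xs
All-lookup⁻ [] _ = []
All-lookup⁻ (x ∷ xs) h = h zero ∷ All-lookup⁻ xs (h ∘ suc)

BelowMaxima : Blocks → Set
BelowMaxima D = ∀ i j {u} → u ∈ blockAt D i → u < maxAt D j

BelowMaxima⇒Separated : ∀ D → LtrBlocks [] D → BelowMaxima D → ∃[ β ] Separated β D
BelowMaxima⇒Separated [] _ _ = 0 , []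
BelowMaxima⇒Separated D@(_ ∷ _) ltr below = maxAt D zero , All-lookup⁻ D λ i →
  All.tabulate (λ u∈ → below i zero u∈) , first-max-≤ i
  where
  first-max-≤ : ∀ i → maxAt D zero ≤ maxAt D i
  first-max-≤ zero = ≤-refl
  first-max-≤ (suc i) = <⇒≤ (LtrBlocks-maxima-< D ltr {zero} {suc i} z<s)

out-via-blocks : ∀ π → out T123-312 π ≡ run T123-312 (flatten (ltrDecomp π)) []
out-via-blocks π = cong (λ l → run T123-312 l []) (sym (flatten-ltrDecomp π))

out-sortedBlocks : ∀ {π} → Unique π → BelowMaxima (ltrDecomp π) →
  out T123-312 π ≡ sortedBlocks (ltrDecomp π) ++ maxima (ltrDecomp π) ʳ++ []
out-sortedBlocks {π} uniq below =
  let ltr = ltrDecomp-LtrBlocks uniq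
      β , sep = BelowMaxima⇒Separated (ltrDecomp π) ltr below
  in trans (out-via-blocks π) (run-separated-blocks (ltrDecomp π) [] [] ltr sep)

-- A block entry u ∈ B_i above some maximum M_j has j < i; u leaves before
-- the maxima, which leave in decreasing order, so u M_i M_j is a 231.
out-avoids-231⇒BelowMaxima : ∀ {π} → Unique π → ¬ Occ231 (out T123-312 π) → BelowMaxima (ltrDecomp π)
out-avoids-231⇒BelowMaxima {π} uniq no231 i j {u} u∈ with u <? maxAt (ltrDecomp π) j
... | yes u<Mj = u<Mj
... | no u≮Mj = contradiction (u , maxAt D i , maxAt D j , τ , Mj<u , u<Mi) no231
  where
  D = ltrDecomp π
  ltr = ltrDecomp-LtrBlocks uniq
  uniqD = subst Unique (sym (flatten-ltrDecomp π)) uniq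
  u<Mi = LtrBlocks-block-< D ltr i u∈
  Mj<u : maxAt D j < u
  Mj<u = ≤∧≢⇒< (≮⇒≥ u≮Mj) (block-≢-max D uniqD i j u∈ ∘ sym)
  j<i : j Fin.< i
  j<i with Fin.<-cmp i j
  ... | tri< i<j _ _ = contradiction (<-trans u<Mi (LtrBlocks-maxima-< D ltr i<j)) u≮Mj
  ... | tri≈ _ refl _ = contradiction u<Mi u≮Mj
  ... | tri> _ _ j<i = j<i
  C = proj₁ (run-blocks D [] ltr)
  out≡ : out T123-312 π ≡ C ++ maxima D ʳ++ []
  out≡ = trans (out-via-blocks π) (proj₂ (run-blocks D [] ltr))
  u∈C : u ∈ C
  u∈π : u ∈ π
  u∈π = subst (u ∈_) (flatten-ltrDecomp π) (blockAt-∈-flatten D i u∈)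
  u∈C with ∈-++⁻ C (subst (u ∈_) out≡ (∈-resp-↭ (↭-sym (run-↭ T123-312 π [])) u∈π))
  ... | inj₁ u∈C = u∈C
  ... | inj₂ u∈M with ∈-maxima-ʳ++⁻ D [] u∈M
  ...   | inj₂ (k , u≡Mk) = contradiction u≡Mk (block-≢-max D uniqD i k u∈)
  τ : (u ∷ maxAt D i ∷ maxAt D j ∷ []) ⊆ out T123-312 π
  τ = subst ((u ∷ maxAt D i ∷ maxAt D j ∷ []) ⊆_) (sym out≡) (++⁺ (from∈ u∈C) (maxima-ʳ++-⊆ D [] j<i))

module SortedOutput {π} (uniq : Unique π) (below : BelowMaxima (ltrDecomp π)) where

  private
    D = ltrDecomp π
    ltr = ltrDecomp-LtrBlocks uniq
    out≡ = out-sortedBlocks uniq below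

  Btilde≡out₁₂ : ∀ j → Btilde π j ≡ out₁₂ (B π j)
  Btilde≡out₁₂ j = trans
    (cong (λ o → take (length (B π j)) (drop (offset π j) o)) out≡)
    (sortedBlocks-window D j (maxima D ʳ++ []))

  ⊆-sortedBlocks⇒⊆-out : ∀ {ws} → ws ⊆ sortedBlocks D → ws ⊆ out T123-312 π
  ⊆-sortedBlocks⇒⊆-out τ = subst (_ ⊆_) (sym out≡) (++⁺ʳ _ τ)

  avoids-231⇒conditions : ¬ Occ231 (out T123-312 π) → Cond2 π × Cond3 π × Cond4 π
  avoids-231⇒conditions no231 = cond2 , cond3 , cond4
    where
    cond2 : Cond2 π
    cond2 i c = no231 (Occ₃-⊆ (⊆-sortedBlocks⇒⊆-out (concatMap-⊆ (out₁₂ ∘ proj₂) D i ⊆-refl))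
      (213⇒out₁₂-231 (B π i) (<ₗ-wellFounded _) (to Contains-213⇔ c)))
    cond3 : Cond3 π
    cond3 (i , j , k , x , y , z , z<x , x<y , x∈ , y∈ , z∈ , i<j , j<k) = no231
      (x , y , z , ⊆-sortedBlocks⇒⊆-out (concatMap-⊆₃ (out₁₂ ∘ proj₂) D i<j j<k
        (∈-out₁₂⁺ _ x∈) (∈-out₁₂⁺ _ y∈) (∈-out₁₂⁺ _ z∈)) , z<x , x<y)
    cond4 : Cond4 π
    cond4 (i , j , x , y , z , z<x , x<y , x∈ , _ , _ , i<j , y≺z) = no231
      (x , y , z , ⊆-sortedBlocks⇒⊆-out (concatMap-⊆₂ (out₁₂ ∘ proj₂) D i<j
        (∈-out₁₂⁺ _ x∈) (subst ((y ∷ z ∷ []) ⊆_) (Btilde≡out₁₂ j) y≺z)) , z<x , x<y)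

  conditions⇒avoids-231 : Cond2 π × Cond3 π × Cond4 π → ¬ Occ231 (out T123-312 π)
  conditions⇒avoids-231 (cond2 , cond3 , cond4) (x , y , z , τ , z<x , x<y) =
    occurrence (split₃ (sortedBlocks D) (subst ((x ∷ y ∷ z ∷ []) ⊆_) out≡ τ))
    where
    below-max : ∀ {u v} → u ∈ sortedBlocks D → v ∈ maxima D ʳ++ [] → u < v
    below-max u∈ v∈ with ∈-concatMap⁻ (out₁₂ ∘ proj₂) D u∈ | ∈-maxima-ʳ++⁻ D [] v∈
    ... | i , u∈′ | inj₂ (k , refl) = below i k (∈-out₁₂⁻ _ u∈′)
    no-ascent : ∀ i → (x ∷ y ∷ []) ⊆ out₁₂ (B π i) → ⊥
    no-ascent i σ = cond2 i (from Contains-213⇔ (out₁₂-ascent⇒213 (B π i) (<ₗ-wellFounded _) σ x<y))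
    occurrence : Split₃ x y z (sortedBlocks D) (maxima D ʳ++ []) → ⊥
    occurrence (all-right σ) =
      <⇒≯ x<y (AllPairs-⊆ (LtrBlocks-ʳ++-decreasing D [] ltr) (⊆-trans (refl ∷ refl ∷ z ∷ʳ []) σ))
    occurrence (one-left x∈ σ) = <⇒≯ z<x (below-max x∈ (head-∈ (∷ˡ⁻ σ)))
    occurrence (two-left σ z∈) = <⇒≯ z<x (below-max (head-∈ σ) z∈)
    occurrence (all-left σ) with spread₃ (out₁₂ ∘ proj₂) D σ
    ... | one-block i σ′ = no-ascent i (⊆-trans (refl ∷ refl ∷ z ∷ʳ []) σ′)
    ... | first-two _ σ′ _ = no-ascent _ σ′
    ... | last-two {i} {j} i<j x∈ σ′ = cond4 (i , j , x , y , z , z<x , x<y , ∈-out₁₂⁻ _ x∈ ,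
            ∈-out₁₂⁻ _ (head-∈ σ′) , ∈-out₁₂⁻ _ (head-∈ (∷ˡ⁻ σ′)) , i<j ,
            subst ((y ∷ z ∷ []) ⊆_) (sym (Btilde≡out₁₂ j)) σ′)
    ... | three-blocks {i} {j} {k} i<j j<k x∈ y∈ z∈ =
            cond3 (i , j , k , x , y , z , z<x , x<y ,
                   ∈-out₁₂⁻ _ x∈ , ∈-out₁₂⁻ _ y∈ , ∈-out₁₂⁻ _ z∈ , i<j , j<k)

consecutive-maxima : ∀ {n m b} D →
  AllPairs (λ p q → proj₁ p < proj₁ q) ((m , b) ∷ D) → All (λ p → proj₁ p ≤ n) ((m , b) ∷ D) →
  (∀ {v} → m ≤ v → v ≤ n → v ∈ maxima ((m , b) ∷ D)) →
  (∀ j → maxAt ((m , b) ∷ D) j ≡ m + toℕ j) × m + length D ≡ n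
consecutive-maxima {n} {m} [] _ (m≤n ∷ []) covered with covered m≤n ≤-refl
... | here n≡m = (λ { zero → sym (+-identityʳ m) }) , trans (+-identityʳ m) (sym n≡m)
consecutive-maxima {n} {m} ((m′ , b′) ∷ D) ((m<m′ ∷ _) ∷ inc) (_ ∷ D≤n) covered =
  at , (begin
    m + suc (length D) ≡⟨ +-suc m (length D) ⟩
    suc m + length D   ≡⟨ cong (_+ length D) m′≡1+m ⟨
    m′ + length D      ≡⟨ last ⟩
    n                  ∎)
  where
  m′≤ : ∀ {v} → v ∈ maxima ((m′ , b′) ∷ D) → m′ ≤ v
  m′≤ (here refl) = ≤-refl
  m′≤ (there v∈) with ∈-map⁻ proj₁ v∈
  ... | _ , p∈D , refl = <⇒≤ (All.lookup (AllPairs.head inc) p∈D)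
  covered′ : ∀ {v} → m′ ≤ v → v ≤ n → v ∈ maxima ((m′ , b′) ∷ D)
  covered′ m′≤v v≤n with covered (≤-trans (<⇒≤ m<m′) m′≤v) v≤n
  ... | here refl = contradiction m′≤v (<⇒≱ m<m′)
  ... | there v∈ = v∈
  m′≡1+m : m′ ≡ suc m
  m′≡1+m with covered (n≤1+n m) (≤-trans m<m′ (All.head D≤n))
  ... | here 1+m≡m = contradiction 1+m≡m 1+n≢n
  ... | there 1+m∈ = ≤-antisym (m′≤ 1+m∈) m<m′
  ih = consecutive-maxima D inc D≤n covered′
  last = proj₂ ih
  at : ∀ j → maxAt ((m , _) ∷ (m′ , b′) ∷ D) j ≡ m + toℕ j
  at zero = sym (+-identityʳ m)
  at (suc j) = begin
    maxAt ((m′ , b′) ∷ D) j ≡⟨ proj₁ ih j ⟩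
    m′ + toℕ j              ≡⟨ cong (_+ toℕ j) m′≡1+m ⟩
    suc m + toℕ j           ≡⟨ +-suc m (toℕ j) ⟨
    m + suc (toℕ j)         ∎

record PermutationBlocks (n : ℕ) (D : Blocks) : Set where
  field
    ltr      : LtrBlocks [] D
    unique   : Unique (flatten D)
    bounded  : ∀ {u} → u ∈ flatten D → 1 ≤ u × u ≤ n
    covering : ∀ {v} → 1 ≤ v → v ≤ n → v ∈ flatten D

↭-idPerm⇒Unique : ∀ {n π} → π ↭ idPerm n → Unique π
↭-idPerm⇒Unique {n} π↭ = Unique-resp-↭ (↭⇒↭ₛ (↭-sym π↭)) (AllPairs.map <⇒≢ (idPerm-increasing n))

ltrDecomp-PermutationBlocks : ∀ {n π} → π ↭ idPerm n → PermutationBlocks n (ltrDecomp π)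
ltrDecomp-PermutationBlocks {n} {π} π↭ = record
  { ltr      = ltrDecomp-LtrBlocks (↭-idPerm⇒Unique π↭)
  ; unique   = subst Unique (sym (flatten-ltrDecomp π)) (↭-idPerm⇒Unique π↭)
  ; bounded  = λ u∈ → bounded (∈-resp-↭ π↭ (subst (_ ∈_) (flatten-ltrDecomp π) u∈))
  ; covering = λ 1≤v v≤n →
      subst (_ ∈_) (sym (flatten-ltrDecomp π)) (∈-resp-↭ (↭-sym π↭) (covering 1≤v v≤n))
  }
  where
  bounded : ∀ {u} → u ∈ idPerm n → 1 ≤ u × u ≤ n
  bounded u∈ with ∈-applyUpTo⁻ suc u∈
  ... | _ , i<n , refl = s≤s z≤n , i<n
  covering : ∀ {v} → 1 ≤ v → v ≤ n → v ∈ idPerm n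
  covering {suc v} _ v<n = ∈-applyUpTo⁺ suc v<n

∸-window : ∀ {n t u} → n ∸ t < u → u ≤ n → ∃[ k ] k < t × n ∸ t + suc k ≡ u
∸-window {n} {t} {u} c<u u≤n = u ∸ suc c , k<t , c+1+k≡u
  where
  c = n ∸ t
  c+1+k≡u : c + suc (u ∸ suc c) ≡ u
  c+1+k≡u = trans (+-suc c _) (m+[n∸m]≡n c<u)
  k<t : u ∸ suc c < t
  k<t = +-cancelˡ-≤ c _ _
    (≤-trans (≤-reflexive c+1+k≡u) (≤-trans u≤n (≤-trans (m≤n+m∸n n t) (≤-reflexive (+-comm t c)))))

-- A block entry u ≥ M_j lies in the window n ∸ t < u ≤ n of the maxima, so
-- it would equal one of them.
top-maxima⇒BelowMaxima : ∀ {n} D → PermutationBlocks n D →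
  (∀ j → maxAt D j ≡ n ∸ length D + suc (toℕ j)) → BelowMaxima D
top-maxima⇒BelowMaxima {n} D P top i j {u} u∈ with u <? maxAt D j
... | yes u<Mj = u<Mj
... | no u≮Mj =
  let k , k<t , c+1+k≡u = ∸-window c<u (proj₂ (bounded (blockAt-∈-flatten D i u∈)))
      kᶠ = Fin.fromℕ< k<t
  in contradiction
    (trans (top kᶠ) (trans (cong (λ l → n ∸ length D + suc l) (Fin.toℕ-fromℕ< k<t)) c+1+k≡u))
    (block-≢-max D unique i kᶠ u∈ ∘ sym)
  where
  open PermutationBlocks P
  c<u : n ∸ length D < u
  c<u = <-≤-trans (m<m+n _ z<s) (≤-trans (≤-reflexive (sym (top j))) (≮⇒≥ u≮Mj))

-- Conversely every value from M₁ to n is then a maximum, so the maxima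
-- are consecutive up to n.
BelowMaxima⇒top-maxima : ∀ {n} D → PermutationBlocks n D → BelowMaxima D →
  ∀ j → maxAt D j ≡ n ∸ length D + suc (toℕ j)
BelowMaxima⇒top-maxima ((zero , b) ∷ D) P _ _ with () ← proj₁ (PermutationBlocks.bounded P (here refl))
BelowMaxima⇒top-maxima {n} D@((suc m , b) ∷ D′) P below j = begin
  maxAt D j                                 ≡⟨ proj₁ consecutive j ⟩
  suc m + toℕ j                             ≡⟨ +-suc m (toℕ j) ⟨
  m + suc (toℕ j)                           ≡⟨ cong (_+ suc (toℕ j)) (m+n∸n≡m m (length D′)) ⟨
  m + length D′ ∸ length D′ + suc (toℕ j)
    ≡⟨ cong (λ l → l ∸ length D + suc (toℕ j)) (proj₂ consecutive) ⟩
  n ∸ length D + suc (toℕ j)                ∎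
  where
  open PermutationBlocks P
  covered : ∀ {v} → suc m ≤ v → v ≤ n → v ∈ maxima D
  covered m≤v v≤n with ∈-flatten⁻ D (covering (≤-trans (s≤s z≤n) m≤v) v≤n)
  ... | inj₁ (i , refl) = maxAt-∈-maxima D i
  ... | inj₂ (i , v∈) = contradiction (below i zero v∈) (≤⇒≯ m≤v)
  consecutive = consecutive-maxima D′ (LtrBlocks-increasing D ltr)
    (All-lookup⁻ D λ i → proj₂ (bounded (maxAt-∈-flatten D i))) covered

mainTheorem11 : (n : ℕ) (π : List ℕ) → π ↭ idPerm n →
    Sortable T123-312 n π ⇔ (Cond1 n π × Cond2 π × Cond3 π × Cond4 π)
mainTheorem11 n π π↭ =
  ⇔-trans (out₂₁-sorts⇔avoids-231 (↭-trans (run-↭ T123-312 π []) π↭)) (mk⇔ conditions avoids-231)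
  where
  P = ltrDecomp-PermutationBlocks π↭
  uniq = ↭-idPerm⇒Unique π↭

  conditions : ¬ Occ231 (out T123-312 π) → Cond1 n π × Cond2 π × Cond3 π × Cond4 π
  conditions no231 =
    let below = out-avoids-231⇒BelowMaxima uniq no231
    in BelowMaxima⇒top-maxima (ltrDecomp π) P below , SortedOutput.avoids-231⇒conditions uniq below no231

  avoids-231 : Cond1 n π × Cond2 π × Cond3 π × Cond4 π → ¬ Occ231 (out T123-312 π)
  avoids-231 (cond1 , cond2-4) =
    SortedOutput.conditions⇒avoids-231 uniq (top-maxima⇒BelowMaxima (ltrDecomp π) P cond1) cond2-4
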